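{- Let $G$ be a graph and $v\in V(G)$. Then $v$ does not lie on any induced odd cycle of $G$ if and only if $v$ is not contained in any minimal oct of $G$.
   Context: All graphs are finite, simple and undirected. An oct of $G$ is a set $Z\subseteq V(G)$ such that $G-Z$ is bipartite; it is minimal if no proper subset of $Z$ is an oct. An induced odd cycle is a cycle of odd length whose vertex set induces exactly that cycle. -}

module Defs where

open import Data.Bool using (Bool; true; false)
open import Data.Nat using (ℕ; suc; _+_; _%_)
open import Data.Fin using (Fin; toℕ)
open import Data.Fin.Subset using (Subset; _∈_; _∉_; _⊂_)
open import Data.Product using (Σ; ∃; _×_)
open import Data.Sum using (_⊎_)
open import Function.Definitions using (Injective)
open import Relation.Binary.PropositionalEquality using (_≡_; _≢_)
open import Relation.Nullary using (¬_)
open import Function.Bundles using (_⇔_)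

record Graph (n : ℕ) : Set where
  field
    adj    : Fin n → Fin n → Bool
    sym    : ∀ u w → adj u w ≡ adj w u
    irrefl : ∀ u → adj u u ≡ false
open Graph public

Adj : ∀ {n} → Graph n → Fin n → Fin n → Set
Adj G u w = adj G u w ≡ true

BipartiteMinus : ∀ {n} → Graph n → Subset n → Set
BipartiteMinus {n} G Z =
  Σ (Fin n → Bool) λ col →
    ∀ u w → u ∉ Z → w ∉ Z → Adj G u w → col u ≢ col w

Oct : ∀ {n} → Graph n → Subset n → Set
Oct G Z = BipartiteMinus G Z

MinimalOct : ∀ {n} → Graph n → Subset n → Set
MinimalOct G Z = Oct G Z × (∀ Z′ → Z′ ⊂ Z → ¬ Oct G Z′)

CycAdj : (k : ℕ) → Fin (suc k) → Fin (suc k) → Set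
CycAdj k i j = (suc (toℕ i) % suc k ≡ toℕ j) ⊎ (suc (toℕ j) % suc k ≡ toℕ i)

-- An induced odd cycle of G of length 2m+3, given by an injective
-- enumeration c of its vertices in cyclic order, such that two cycle
-- vertices are adjacent in G iff they are consecutive on the cycle.
record InducedOddCycle {n} (G : Graph n) : Set where
  field
    m       : ℕ
    c       : Fin (suc (suc (suc (m + m)))) → Fin n
    inj     : Injective _≡_ _≡_ c
    induced : ∀ i j → Adj G (c i) (c j) ⇔ CycAdj (suc (suc (m + m))) i j
open InducedOddCycle public

OnInducedOddCycle : ∀ {n} → Graph n → Fin n → Set
OnInducedOddCycle {n} G v =
  Σ (InducedOddCycle G) λ C → ∃ λ i → c C i ≡ v

InMinimalOct : ∀ {n} → Graph n → Fin n → Set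
InMinimalOct {n} G v = Σ (Subset n) λ Z → MinimalOct G Z × v ∈ Z

-- If v lies on an induced odd cycle C, the vertices off C − v form an oct, since C − v is an
-- induced path; any minimal oct inside it must contain v, for otherwise C survives in its complement.
-- Conversely, let Z be a minimal oct containing v. In G − (Z − v) a shortest odd closed walk has no
-- repeated vertex and no chord, so it is an induced odd cycle, and it passes through v because
-- G − Z is bipartite. So if v lies on no induced odd cycle, G − (Z − v) has no odd closed walk:
-- colouring the vertices reachable from v by the parity of the walks reaching them (decidable,
-- as such walks shorten to length ≤ n keeping their parity) and the others as in G − Z shows
-- that Z − v is an oct, against minimality.

{-# OPTIONS --safe #-}
module Submission where

open import Defs hiding (sym; irrefl)
open import Data.Bool using (Bool; true; false; not; _xor_)
import Data.Bool as Bool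
open import Data.Bool.Properties using (not-involutive; not-distribˡ-xor; not-distribʳ-xor; ¬-not; not-¬; xor-identityʳ; xor-same)
open import Data.Empty using (⊥-elim)
open import Data.Fin using (Fin; zero; suc; toℕ; fromℕ<) renaming (_≟_ to _≟ᶠ_)
open import Data.Fin.Properties using (all?; any?; toℕ<n; toℕ-fromℕ<; toℕ-injective; pigeonhole)
open import Data.Fin.Subset using (Subset; _∈_; _∉_; _⊂_; _⊆_; _-_; ∁)
open import Data.Fin.Subset.Induction using (⊂-wellFounded; Acc; acc)
open import Data.Fin.Subset.Properties
  using (_∈?_; _⊂?_; anySubset?; ⊆-refl; ⊆-trans; x∈p∧x≢y⇒x∈p-y; x∈p⇒p-x⊂p; x∉∁p⇒x∈p; x∈p⇒x∉∁p)
open import Data.Nat using (ℕ; zero; suc; _+_; _∸_; _%_; _≤_; _<_; z≤n; s≤s; z<s; s≤s⁻¹; _≤?_; _<?_)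
  renaming (_≟_ to _≟ⁿ_)
open import Data.Nat.DivMod using (m<n⇒m%n≡m; n%n≡0; m%n<n)
open import Data.Nat.Induction using (<-wellFounded)
open import Data.Nat.Properties
open import Data.Nat.Tactic.RingSolver using (solve-∀)
open import Data.Product using (Σ; ∃; _×_; _,_; proj₁; proj₂)
open import Data.Sum using (_⊎_; inj₁; inj₂; swap)
import Data.Sum as Sum
open import Data.Vec using (lookup; tabulate; _∷_)
open import Data.Vec.Base using (there)
open import Data.Vec.Properties using (lookup∘tabulate; []=⇒lookup; lookup⇒[]=)
open import Function using (_∘_)
open import Function.Bundles using (_⇔_; mk⇔; Equivalence)
open import Relation.Binary.Definitions using (tri<; tri≈; tri>)
open import Relation.Binary.PropositionalEquality
open import Relation.Nullary using (¬_; Dec; yes; no; does)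
open import Relation.Nullary.Decidable using (map′; _×-dec_; _⊎-dec_; _→-dec_; ¬?; dec-true)
open import Relation.Unary using (Pred; Decidable)
open import Level using (0ℓ)

-- Parity

isOdd : ℕ → Bool
isOdd zero    = false
isOdd (suc n) = not (isOdd n)

isOdd-+ : ∀ m n → isOdd (m + n) ≡ isOdd m xor isOdd n
isOdd-+ zero    n = refl
isOdd-+ (suc m) n = trans (cong not (isOdd-+ m n)) (not-distribˡ-xor (isOdd m) (isOdd n))

isOdd-double : ∀ m → isOdd (m + m) ≡ false
isOdd-double zero    = refl
isOdd-double (suc m) = begin
  not (isOdd (m + suc m))    ≡⟨ cong (not ∘ isOdd) (+-suc m m) ⟩
  not (not (isOdd (m + m)))  ≡⟨ not-involutive _ ⟩
  isOdd (m + m)              ≡⟨ isOdd-double m ⟩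
  false                      ∎
  where open ≡-Reasoning

isOdd⇒≡suc-double : ∀ n → isOdd n ≡ true → ∃ λ h → n ≡ suc (h + h)
isOdd⇒≡suc-double (suc zero)    _   = 0 , refl
isOdd⇒≡suc-double (suc (suc n)) odd with isOdd⇒≡suc-double n (trans (sym (not-involutive _)) odd)
... | h , refl = suc h , cong (λ k → suc (suc k)) (sym (+-suc h h))

isOdd-cycleLength : ∀ m → isOdd (suc (suc (suc (m + m)))) ≡ true
isOdd-cycleLength m = trans (not-involutive _) (cong not (isOdd-double m))

summand< : ∀ {k ℓ} x y → x + y ≡ k + ℓ → k < y → x < ℓ
summand< {k} {ℓ} x y x+y≡k+ℓ k<y =
  +-cancelˡ-< k x ℓ (subst₂ _<_ (+-comm x k) x+y≡k+ℓ (+-monoʳ-< x k<y))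

isOdd-summands : ∀ k ℓ x y → x + y ≡ k + ℓ → isOdd k ≡ false → isOdd x xor isOdd y ≡ isOdd ℓ
isOdd-summands k ℓ x y x+y≡k+ℓ k-even = begin
  isOdd x xor isOdd y  ≡⟨ isOdd-+ x y ⟨
  isOdd (x + y)        ≡⟨ cong isOdd x+y≡k+ℓ ⟩
  isOdd (k + ℓ)        ≡⟨ isOdd-+ k ℓ ⟩
  isOdd k xor isOdd ℓ  ≡⟨ cong (_xor isOdd ℓ) k-even ⟩
  isOdd ℓ              ∎
  where open ≡-Reasoning

true≢false : true ≢ false
true≢false ()

xor-cancelˡ : ∀ x y → x ≡ x xor y → y ≡ false
xor-cancelˡ false y   x≡ = sym x≡
xor-cancelˡ true true ()
xor-cancelˡ true false _ = refl

xor≡true : ∀ x y → x xor y ≡ true → x ≡ true ⊎ y ≡ true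
xor≡true true  _ _   = inj₁ refl
xor≡true false _ y≡t = inj₂ y≡t

-- Graphs, subsets and octs

module _ {n} (G : Graph n) where

  Adj-sym : ∀ {a b} → Adj G a b → Adj G b a
  Adj-sym {a} {b} = trans (Graph.sym G b a)

  Adj-irrefl : ∀ {a} → ¬ Adj G a a
  Adj-irrefl {a} a~a with trans (sym a~a) (Graph.irrefl G a)
  ... | ()

  Adj? : ∀ a b → Dec (Adj G a b)
  Adj? a b = adj G a b Bool.≟ true

x∉p-x : ∀ {n} (p : Subset n) x → x ∉ p - x
x∉p-x (_ ∷ p) zero    ()
x∉p-x (_ ∷ p) (suc x) (there x∈) = x∉p-x p x x∈

x∉p-y∧x≢y⇒x∉p : ∀ {n} {p : Subset n} {x y} → x ∉ p - y → x ≢ y → x ∉ p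
x∉p-y∧x≢y⇒x∉p x∉p-y x≢y x∈p = x∉p-y (x∈p∧x≢y⇒x∈p-y x∈p x≢y)

module _ {n} {P : Pred (Fin n) 0ℓ} (P? : Decidable P) where

  fromDec : Subset n
  fromDec = tabulate (does ∘ P?)

  ∈-fromDec⁺ : ∀ {x} → P x → x ∈ fromDec
  ∈-fromDec⁺ {x} px = lookup⇒[]= x fromDec (trans (lookup∘tabulate (does ∘ P?) x) (dec-true (P? x) px))

  ∈-fromDec⁻ : ∀ {x} → x ∈ fromDec → P x
  ∈-fromDec⁻ {x} x∈ with P? x | trans (sym (lookup∘tabulate (does ∘ P?) x)) ([]=⇒lookup x∈)
  ... | yes px | _ = px
  ... | no _   | ()

module _ {n} {P : Pred (Subset n) 0ℓ} (P? : Decidable P) where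

  ⊂-minimal : ∀ {Z} → P Z → ∃ λ Z* → Z* ⊆ Z × P Z* × (∀ Z′ → Z′ ⊂ Z* → ¬ P Z′)
  ⊂-minimal {Z} = go (⊂-wellFounded Z)
    where
    go : ∀ {Z} → Acc _⊂_ Z → P Z → ∃ λ Z* → Z* ⊆ Z × P Z* × (∀ Z′ → Z′ ⊂ Z* → ¬ P Z′)
    go {Z} (acc below) pZ with anySubset? (λ Z′ → Z′ ⊂? Z ×-dec P? Z′)
    ... | no ∄smaller = Z , ⊆-refl , pZ , λ Z′ Z′⊂Z pZ′ → ∄smaller (Z′ , Z′⊂Z , pZ′)
    ... | yes (Z′ , Z′⊂Z , pZ′) with go (below Z′⊂Z) pZ′
    ...   | Z* , Z*⊆Z′ , pZ* , minimal = Z* , ⊆-trans Z*⊆Z′ (proj₁ Z′⊂Z) , pZ* , minimal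

module _ {n} (G : Graph n) where

  ProperColouring : Subset n → (Fin n → Bool) → Set
  ProperColouring Z col = ∀ u w → u ∉ Z → w ∉ Z → Adj G u w → col u ≢ col w

  properColouring? : ∀ Z col → Dec (ProperColouring Z col)
  properColouring? Z col = all? λ u → all? λ w →
    ¬? (u ∈? Z) →-dec ¬? (w ∈? Z) →-dec Adj? G u w →-dec ¬? (col u Bool.≟ col w)

  properColouring-resp : ∀ {Z col col′} → (∀ u → col u ≡ col′ u) →
                         ProperColouring Z col → ProperColouring Z col′
  properColouring-resp col≗col′ proper u w u∉ w∉ u~w same =
    proper u w u∉ w∉ u~w (trans (col≗col′ u) (trans same (sym (col≗col′ w))))

  -- A colouring is a Boolean vector, that is, a subset; anySubset? searches them all.
  oct? : ∀ Z → Dec (Oct G Z)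
  oct? Z = map′ (λ (s , proper) → lookup s , proper)
                (λ (col , proper) → tabulate col , properColouring-resp (sym ∘ lookup∘tabulate col) proper)
                (anySubset? (properColouring? Z ∘ lookup))

-- Positions on a cycle

Consecutive : ℕ → ℕ → ℕ → Set
Consecutive ℓ x y = suc x ≡ y ⊎ (suc x ≡ ℓ × y ≡ 0)

suc-%≡⇒Consecutive : ∀ {k x y} → x < suc k → suc x % suc k ≡ y → Consecutive (suc k) x y
suc-%≡⇒Consecutive {k} {x} x<1+k sx%≡y with suc x <? suc k
... | yes sx<1+k = inj₁ (trans (sym (m<n⇒m%n≡m sx<1+k)) sx%≡y)
... | no  sx≮1+k = inj₂ (sx≡1+k , trans (sym sx%≡y) (trans (cong (_% suc k) sx≡1+k) (n%n≡0 (suc k))))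
  where sx≡1+k = ≤-antisym x<1+k (≮⇒≥ sx≮1+k)

Consecutive⇒suc-%≡ : ∀ {k x y} → y < suc k → Consecutive (suc k) x y → suc x % suc k ≡ y
Consecutive⇒suc-%≡     y<1+k (inj₁ refl)          = m<n⇒m%n≡m y<1+k
Consecutive⇒suc-%≡ {k} _     (inj₂ (sx≡1+k , refl)) = trans (cong (_% suc k) sx≡1+k) (n%n≡0 (suc k))

CycAdj⇔Consecutive : ∀ {k} (i j : Fin (suc k)) →
  CycAdj k i j ⇔ (Consecutive (suc k) (toℕ i) (toℕ j) ⊎ Consecutive (suc k) (toℕ j) (toℕ i))
CycAdj⇔Consecutive i j = mk⇔
  (Sum.map (suc-%≡⇒Consecutive (toℕ<n i)) (suc-%≡⇒Consecutive (toℕ<n j)))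
  (Sum.map (Consecutive⇒suc-%≡ (toℕ<n j)) (Consecutive⇒suc-%≡ (toℕ<n i)))

-- Walks

module Walks {n} (G : Graph n) (Z : Subset n) where

  -- A walk in G − Z through pt 0, …, pt len; the values of pt beyond len are irrelevant.
  record Walk (a b : Fin n) : Set where
    field
      len    : ℕ
      pt     : ℕ → Fin n
      pt-0   : pt 0 ≡ a
      pt-len : pt len ≡ b
      step   : ∀ i → i < len → Adj G (pt i) (pt (suc i))
      avoids : ∀ i → i ≤ len → pt i ∉ Z
  open Walk public

  private
    variable
      a a′ b b′ d : Fin n

  start-avoids : Walk a b → a ∉ Z
  start-avoids W = subst (_∉ Z) (pt-0 W) (avoids W 0 z≤n)

  end-avoids : Walk a b → b ∉ Z
  end-avoids W = subst (_∉ Z) (pt-len W) (avoids W (len W) ≤-refl)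

  retarget : a ≡ a′ → b ≡ b′ → Walk a b → Walk a′ b′
  retarget a≡a′ b≡b′ W = record
    { len = len W ; pt = pt W ; pt-0 = trans (pt-0 W) a≡a′ ; pt-len = trans (pt-len W) b≡b′
    ; step = step W ; avoids = avoids W }

  nil : a ∉ Z → Walk a a
  nil {a} a∉Z = record
    { len = 0 ; pt = λ _ → a ; pt-0 = refl ; pt-len = refl
    ; step = λ _ () ; avoids = λ _ _ → a∉Z }

  edge : Adj G a b → a ∉ Z → b ∉ Z → Walk a b
  edge {a} {b} a~b a∉Z b∉Z = record
    { len = 1 ; pt = λ { zero → a ; (suc _) → b } ; pt-0 = refl ; pt-len = refl
    ; step = λ { zero _ → a~b ; (suc _) (s≤s ()) }
    ; avoids = λ { zero _ → a∉Z ; (suc _) _ → b∉Z } }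

  segment : (W : Walk a b) (i k : ℕ) → i + k ≤ len W → Walk (pt W i) (pt W (i + k))
  segment W i k i+k≤ = record
    { len = k ; pt = λ t → pt W (i + t) ; pt-0 = cong (pt W) (+-identityʳ i) ; pt-len = refl
    ; step = λ t t<k → subst (λ s → Adj G (pt W (i + t)) (pt W s)) (sym (+-suc i t))
                             (step W (i + t) (<-≤-trans (+-monoʳ-< i t<k) i+k≤))
    ; avoids = λ t t≤k → avoids W (i + t) (≤-trans (+-monoʳ-≤ i t≤k) i+k≤) }

  join : ℕ → (ℕ → Fin n) → (ℕ → Fin n) → ℕ → Fin n
  join l f g k with k ≤? l
  ... | yes _ = f k
  ... | no  _ = g (k ∸ l)

  join-≤ : ∀ {l f g k} → k ≤ l → join l f g k ≡ f k
  join-≤ {l} {k = k} k≤l with k ≤? l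
  ... | yes _   = refl
  ... | no  k≰l = ⊥-elim (k≰l k≤l)

  join-≥ : ∀ {l f g k} → f l ≡ g 0 → l ≤ k → join l f g k ≡ g (k ∸ l)
  join-≥ {l} {g = g} {k} fl≡g0 l≤k with k ≤? l
  ... | no  _   = refl
  ... | yes k≤l with ≤-antisym k≤l l≤k
  ...   | refl = trans fl≡g0 (cong g (sym (n∸n≡0 k)))

  infixr 5 _++_
  _++_ : Walk a b → Walk b d → Walk a d
  W₁ ++ W₂ = record
    { len    = l₁ + len W₂
    ; pt     = join l₁ (pt W₁) (pt W₂)
    ; pt-0   = trans (join-≤ {l₁} {pt W₁} {pt W₂} z≤n) (pt-0 W₁)
    ; pt-len = trans (join-≥ meet (m≤m+n l₁ _)) (trans (cong (pt W₂) (m+n∸m≡n l₁ _)) (pt-len W₂))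
    ; step   = step′
    ; avoids = avoids′ }
    where
    l₁ = len W₁
    meet : pt W₁ l₁ ≡ pt W₂ 0
    meet = trans (pt-len W₁) (sym (pt-0 W₂))
    step′ : ∀ i → i < l₁ + len W₂ → Adj G (join l₁ (pt W₁) (pt W₂) i) (join l₁ (pt W₁) (pt W₂) (suc i))
    step′ i i< = stepBy (suc i ≤? l₁)
      where
      stepBy : Dec (i < l₁) → Adj G (join l₁ (pt W₁) (pt W₂) i) (join l₁ (pt W₁) (pt W₂) (suc i))
      stepBy (yes i<l₁) = subst₂ (Adj G) (sym (join-≤ (<⇒≤ i<l₁))) (sym (join-≤ i<l₁)) (step W₁ i i<l₁)
      stepBy (no  i≮l₁) = subst₂ (Adj G) (sym (join-≥ meet l₁≤i))
                            (sym (trans (join-≥ meet (m≤n⇒m≤1+n l₁≤i)) (cong (pt W₂) (+-∸-assoc 1 l₁≤i))))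
                            (step W₂ (i ∸ l₁) (subst (i ∸ l₁ <_) (m+n∸m≡n l₁ _) (∸-monoˡ-< i< l₁≤i)))
        where l₁≤i = s≤s⁻¹ (≰⇒> i≮l₁)
    avoids′ : ∀ i → i ≤ l₁ + len W₂ → join l₁ (pt W₁) (pt W₂) i ∉ Z
    avoids′ i i≤ with i ≤? l₁
    ... | yes i≤l₁ = avoids W₁ i i≤l₁
    ... | no  _    = avoids W₂ (i ∸ l₁) (subst (i ∸ l₁ ≤_) (m+n∸m≡n l₁ _) (∸-monoˡ-≤ l₁ i≤))

  reverse : Walk a b → Walk b a
  reverse W = record
    { len    = ℓ
    ; pt     = λ k → pt W (ℓ ∸ k)
    ; pt-0   = pt-len W
    ; pt-len = trans (cong (pt W) (n∸n≡0 ℓ)) (pt-0 W)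
    ; step   = λ k k<ℓ → let ℓ∸k≡ = +-∸-assoc 1 k<ℓ in
                 subst (λ s → Adj G (pt W s) (pt W (ℓ ∸ suc k))) (sym ℓ∸k≡)
                   (Adj-sym G (step W (ℓ ∸ suc k) (subst (_≤ ℓ) ℓ∸k≡ (m∸n≤m ℓ k))))
    ; avoids = λ k _ → avoids W (ℓ ∸ k) (m∸n≤m ℓ k) }
    where ℓ = len W

  closedWalk-even : Oct G Z → (W : Walk a a) → isOdd (len W) ≡ false
  closedWalk-even (col , proper) W = xor-cancelˡ (col (pt W 0)) (isOdd (len W)) (begin
    col (pt W 0)                    ≡⟨ cong col (trans (pt-0 W) (sym (pt-len W))) ⟩
    col (pt W (len W))              ≡⟨ colour-along (len W) ≤-refl ⟩
    col (pt W 0) xor isOdd (len W)  ∎)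
    where
    open ≡-Reasoning
    colour-along : ∀ k → k ≤ len W → col (pt W k) ≡ col (pt W 0) xor isOdd k
    colour-along zero    _   = sym (xor-identityʳ _)
    colour-along (suc k) k<ℓ = begin
      col (pt W (suc k))              ≡⟨ ¬-not (≢-sym (proper _ _ (avoids W k (<⇒≤ k<ℓ)) (avoids W (suc k) k<ℓ) (step W k k<ℓ))) ⟩
      not (col (pt W k))              ≡⟨ cong not (colour-along k (<⇒≤ k<ℓ)) ⟩
      not (col (pt W 0) xor isOdd k)  ≡⟨ not-distribʳ-xor (col (pt W 0)) (isOdd k) ⟩
      col (pt W 0) xor isOdd (suc k)  ∎

  record Split (W : Walk a b) : Set where
    field
      {hub}  : Fin n
      loop   : Walk hub hub
      rest   : Walk a b
      loop<  : len loop < len W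
      rest<  : len rest < len W
      parity : isOdd (len loop) xor isOdd (len rest) ≡ isOdd (len W)

  split-by : ∀ {h k} {W : Walk a b} (loop : Walk h h) (rest : Walk a b) →
             len loop + len rest ≡ k + len W → isOdd k ≡ false → k < len loop → k < len rest → Split W
  split-by {k = k} {W} loop rest lengths k-even k<loop k<rest = record
    { loop   = loop
    ; rest   = rest
    ; loop<  = summand< (len loop) (len rest) lengths k<rest
    ; rest<  = summand< (len rest) (len loop) (trans (+-comm (len rest) (len loop)) lengths) k<loop
    ; parity = isOdd-summands k (len W) (len loop) (len rest) lengths k-even }

  repeat-split : (W : Walk a b) (i d e : ℕ) → suc (suc i + d) + e ≡ len W →
                 pt W i ≡ pt W (suc i + d) → Split W
  repeat-split {a} {b} W i d e len≡ pᵢ≡pⱼ = split-by loop rest lengths refl z<s (subst (0 <_) (sym (+-suc i e)) z<s)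
    where
    j = suc i + d
    j+1+e≡ℓ : j + suc e ≡ len W
    j+1+e≡ℓ = trans (+-suc j e) len≡
    j≤ℓ : j ≤ len W
    j≤ℓ = ≤-trans (m≤m+n j (suc e)) (≤-reflexive j+1+e≡ℓ)
    loop : Walk (pt W i) (pt W i)
    loop = retarget refl (trans (cong (pt W) (+-suc i d)) (sym pᵢ≡pⱼ))
             (segment W i (suc d) (subst (_≤ len W) (sym (+-suc i d)) j≤ℓ))
    rest : Walk a b
    rest = retarget (pt-0 W) (trans (cong (pt W) j+1+e≡ℓ) (pt-len W))
             (segment W 0 i (≤-trans (m≤m+n i (suc d)) (≤-trans (≤-reflexive (+-suc i d)) j≤ℓ)) ++
              retarget (sym pᵢ≡pⱼ) refl (segment W j (suc e) (≤-reflexive j+1+e≡ℓ)))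
    lengths : suc d + (i + suc e) ≡ 0 + len W
    lengths = trans (reorder i d e) len≡
      where
      reorder : ∀ i d e → suc d + (i + suc e) ≡ suc (suc i + d) + e
      reorder = solve-∀

  -- The chord is traversed by both parts, so their lengths add up to len W + 2.
  chord-split : (W : Walk a b) (i d e : ℕ) → suc (suc i + d) + e ≡ len W →
                Adj G (pt W i) (pt W (suc i + d)) → 0 < d → 0 < i + e → Split W
  chord-split {a} {b} W i d e len≡ chord 0<d 0<i+e =
    split-by loop rest lengths refl (s≤s (s≤s 0<d))
      (subst (2 <_) (sym (trans (+-suc i (suc e)) (cong suc (+-suc i e)))) (s≤s (s≤s 0<i+e)))
    where
    j = suc i + d
    j+1+e≡ℓ : j + suc e ≡ len W
    j+1+e≡ℓ = trans (+-suc j e) len≡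
    j≤ℓ : j ≤ len W
    j≤ℓ = ≤-trans (m≤m+n j (suc e)) (≤-reflexive j+1+e≡ℓ)
    i≤ℓ : i ≤ len W
    i≤ℓ = ≤-trans (m≤m+n i (suc d)) (≤-trans (≤-reflexive (+-suc i d)) j≤ℓ)
    pᵢ∉Z = avoids W i i≤ℓ
    pⱼ∉Z = avoids W j j≤ℓ
    loop : Walk (pt W j) (pt W j)
    loop = edge (Adj-sym G chord) pⱼ∉Z pᵢ∉Z ++
           retarget refl (cong (pt W) (+-suc i d)) (segment W i (suc d) (subst (_≤ len W) (sym (+-suc i d)) j≤ℓ))
    rest : Walk a b
    rest = retarget (pt-0 W) (trans (cong (pt W) j+1+e≡ℓ) (pt-len W))
             (segment W 0 i i≤ℓ ++ edge chord pᵢ∉Z pⱼ∉Z ++ segment W j (suc e) (≤-reflexive j+1+e≡ℓ))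
    lengths : suc (suc d) + (i + suc (suc e)) ≡ 2 + len W
    lengths = trans (reorder i d e) (cong (2 +_) len≡)
      where
      reorder : ∀ i d e → suc (suc d) + (i + suc (suc e)) ≡ 2 + (suc (suc i + d) + e)
      reorder = solve-∀

  Chord : Walk a b → ℕ → ℕ → Set
  Chord W i j = Adj G (pt W i) (pt W j) × suc i ≢ j × ¬ (i ≡ 0 × suc j ≡ len W)

  Defect : Walk a b → ℕ → ℕ → Set
  Defect W i j = pt W i ≡ pt W j ⊎ Chord W i j

  defect? : (W : Walk a b) → Dec (∃ λ j → j < len W × ∃ λ i → i < j × Defect W i j)
  defect? W = anyUpTo? (λ j → anyUpTo? (λ i → defectAt? i j) j) (len W)
    where
    defectAt? : ∀ i j → Dec (Defect W i j)
    defectAt? i j = (pt W i ≟ᶠ pt W j) ⊎-dec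
      (Adj? G (pt W i) (pt W j) ×-dec ¬? (suc i ≟ⁿ j) ×-dec ¬? ((i ≟ⁿ 0) ×-dec (suc j ≟ⁿ len W)))

  defect⇒split : (W : Walk a b) {i j : ℕ} → i < j → j < len W → Defect W i j → Split W
  defect⇒split W {i} i<j j<ℓ defect with m≤n⇒∃[o]m+o≡n i<j | m≤n⇒∃[o]m+o≡n j<ℓ
  ... | d , refl | e , len≡ with defect
  ...   | inj₁ repeat                 = repeat-split W i d e len≡ repeat
  ...   | inj₂ (chord , 1+i≢j , ¬wrap) = chord-split W i d e len≡ chord (n≢0⇒n>0 d≢0) (n≢0⇒n>0 i+e≢0)
    where
    d≢0 : d ≢ 0
    d≢0 refl = 1+i≢j (sym (+-identityʳ (suc i)))
    i+e≢0 : i + e ≢ 0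
    i+e≢0 i+e≡0 with m+n≡0⇒m≡0 i i+e≡0 | m+n≡0⇒n≡0 i i+e≡0
    ... | refl | refl = ¬wrap (refl , trans (sym (+-identityʳ _)) len≡)

  AvoidingInducedOddCycle : Set
  AvoidingInducedOddCycle = Σ (InducedOddCycle G) λ C → ∀ i → c C i ∉ Z

  cycleWalk : (C : InducedOddCycle G) → (∀ i → c C i ∉ Z) → Walk (c C zero) (c C zero)
  cycleWalk C C-avoids = record
    { len    = L
    ; pt     = c C ∘ position
    ; pt-0   = refl
    ; pt-len = cong (c C) (toℕ-injective (trans (toℕ-fromℕ< _) (n%n≡0 L)))
    ; step   = λ k k<L → Equivalence.from (induced C (position k) (position (suc k))) (inj₁ (begin
        suc (toℕ (position k)) % L  ≡⟨ cong (λ x → suc x % L) (trans (toℕ-fromℕ< _) (m<n⇒m%n≡m k<L)) ⟩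
        suc k % L                   ≡⟨ toℕ-fromℕ< _ ⟨
        toℕ (position (suc k))      ∎))
    ; avoids = λ k _ → C-avoids (position k) }
    where
    open ≡-Reasoning
    L = suc (suc (suc (m C + m C)))
    position : ℕ → Fin L
    position k = fromℕ< (m%n<n k L)

  oct⇒¬inducedOddCycle : Oct G Z → ¬ AvoidingInducedOddCycle
  oct⇒¬inducedOddCycle oct (C , C-avoids) =
    true≢false (trans (sym (isOdd-cycleLength (m C))) (closedWalk-even oct (cycleWalk C C-avoids)))

  split-odd : {W : Walk a a} → Split W → isOdd (len W) ≡ true →
              Σ (Fin n) λ x → Σ (Walk x x) λ W′ → len W′ < len W × isOdd (len W′) ≡ true
  split-odd s W-odd with xor≡true _ _ (trans (Split.parity s) W-odd)
  ... | inj₁ loop-odd = _ , Split.loop s , Split.loop< s , loop-odd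
  ... | inj₂ rest-odd = _ , Split.rest s , Split.rest< s , rest-odd

  module DefectFree {a} (W : Walk a a) (free : ∀ {i j} → i < j → j < len W → ¬ Defect W i j) where

    pt-injective : ∀ {x y} → x < len W → y < len W → pt W x ≡ pt W y → x ≡ y
    pt-injective {x} {y} x<ℓ y<ℓ pₓ≡pᵧ with <-cmp x y
    ... | tri< x<y _ _ = ⊥-elim (free x<y y<ℓ (inj₁ pₓ≡pᵧ))
    ... | tri≈ _ x≡y _ = x≡y
    ... | tri> _ _ y<x = ⊥-elim (free y<x x<ℓ (inj₁ (sym pₓ≡pᵧ)))

    ordered-adjacent⇒consecutive : ∀ {x y} → x < y → y < len W → Adj G (pt W x) (pt W y) →
                                   Consecutive (len W) x y ⊎ Consecutive (len W) y x
    ordered-adjacent⇒consecutive {x} {y} x<y y<ℓ x~y with suc x ≟ⁿ y | (x ≟ⁿ 0) ×-dec (suc y ≟ⁿ len W)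
    ... | yes 1+x≡y | _                  = inj₁ (inj₁ 1+x≡y)
    ... | no  _     | yes (x≡0 , 1+y≡ℓ) = inj₂ (inj₂ (1+y≡ℓ , x≡0))
    ... | no  1+x≢y | no  ¬wrap          = ⊥-elim (free x<y y<ℓ (inj₂ (x~y , 1+x≢y , ¬wrap)))

    adjacent⇒consecutive : ∀ {x y} → x < len W → y < len W → Adj G (pt W x) (pt W y) →
                           Consecutive (len W) x y ⊎ Consecutive (len W) y x
    adjacent⇒consecutive {x} {y} x<ℓ y<ℓ x~y with <-cmp x y
    ... | tri< x<y _ _  = ordered-adjacent⇒consecutive x<y y<ℓ x~y
    ... | tri≈ _ refl _ = ⊥-elim (Adj-irrefl G x~y)
    ... | tri> _ _ y<x  = swap (ordered-adjacent⇒consecutive y<x x<ℓ (Adj-sym G x~y))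

    consecutive⇒adjacent : ∀ {x y} → x < len W → Consecutive (len W) x y → Adj G (pt W x) (pt W y)
    consecutive⇒adjacent {x} x<ℓ (inj₁ refl)           = step W x x<ℓ
    consecutive⇒adjacent {x} x<ℓ (inj₂ (1+x≡ℓ , refl)) =
      subst (Adj G (pt W x)) (trans (cong (pt W) 1+x≡ℓ) (trans (pt-len W) (sym (pt-0 W)))) (step W x x<ℓ)

    cycle : ∀ m → len W ≡ suc (suc (suc (m + m))) → AvoidingInducedOddCycle
    cycle m ℓ≡L = C , λ i → avoids W (toℕ i) (<⇒≤ (bounded i))
      where
      L = suc (suc (suc (m + m)))
      bounded : (i : Fin L) → toℕ i < len W
      bounded i = subst (toℕ i <_) (sym ℓ≡L) (toℕ<n i)
      resize : ∀ {ℓ ℓ′ x y} → ℓ ≡ ℓ′ → Consecutive ℓ x y → Consecutive ℓ′ x y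
      resize {x = x} {y} = subst (λ ℓ → Consecutive ℓ x y)
      C : InducedOddCycle G
      C = record
        { m       = m
        ; c       = pt W ∘ toℕ
        ; inj     = λ {i} {j} pᵢ≡pⱼ → toℕ-injective (pt-injective (bounded i) (bounded j) pᵢ≡pⱼ)
        ; induced = λ i j → mk⇔
            (λ i~j → Equivalence.from (CycAdj⇔Consecutive i j)
              (Sum.map (resize ℓ≡L) (resize ℓ≡L) (adjacent⇒consecutive (bounded i) (bounded j) i~j)))
            (λ cyc → Sum.[ consecutive⇒adjacent (bounded i) ∘ resize (sym ℓ≡L)
                         , Adj-sym G ∘ consecutive⇒adjacent (bounded j) ∘ resize (sym ℓ≡L) ]′
              (Equivalence.to (CycAdj⇔Consecutive i j) cyc))
        }

    inducedOddCycle : isOdd (len W) ≡ true → AvoidingInducedOddCycle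
    inducedOddCycle W-odd with isOdd⇒≡suc-double (len W) W-odd
    ... | zero  , ℓ≡1 = ⊥-elim (Adj-irrefl G (consecutive⇒adjacent (subst (0 <_) (sym ℓ≡1) z<s) (inj₂ (sym ℓ≡1 , refl))))
    ... | suc m , ℓ≡  = cycle m (trans ℓ≡ (cong (λ k → suc (suc k)) (+-suc m m)))

  oddClosedWalk⇒inducedOddCycle : (W : Walk a a) → isOdd (len W) ≡ true → AvoidingInducedOddCycle
  oddClosedWalk⇒inducedOddCycle W = go W (<-wellFounded (len W))
    where
    go : ∀ {a} (W : Walk a a) → Acc _<_ (len W) → isOdd (len W) ≡ true → AvoidingInducedOddCycle
    go W (acc shorter) W-odd with defect? W
    ... | no  ∄defect = DefectFree.inducedOddCycle W (λ i<j j<ℓ δ → ∄defect (_ , j<ℓ , _ , i<j , δ)) W-odd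
    ... | yes (_ , j<ℓ , _ , i<j , δ) with split-odd (defect⇒split W i<j j<ℓ δ) W-odd
    ...   | _ , W′ , W′<W , W′-odd = go W′ (shorter W′<W) W′-odd

  walkOfLength? : ∀ a ℓ u → Dec (Σ (Walk a u) λ W → len W ≡ ℓ)
  walkOfLength? a zero u = map′
    (λ { (refl , a∉Z) → nil a∉Z , refl })
    (λ (W , ℓ≡0) → trans (sym (pt-len W)) (trans (cong (pt W) ℓ≡0) (pt-0 W)) , start-avoids W)
    ((u ≟ᶠ a) ×-dec ¬? (a ∈? Z))
  walkOfLength? a (suc ℓ) u = map′ snoc unsnoc
    (any? λ x → walkOfLength? a ℓ x ×-dec Adj? G x u ×-dec ¬? (u ∈? Z))
    where
    snoc : (∃ λ x → (Σ (Walk a x) λ W → len W ≡ ℓ) × Adj G x u × u ∉ Z) → Σ (Walk a u) λ W → len W ≡ suc ℓ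
    snoc (x , (W , ℓ≡) , x~u , u∉Z) = W ++ edge x~u (end-avoids W) u∉Z , trans (+-comm (len W) 1) (cong suc ℓ≡)
    unsnoc : (Σ (Walk a u) λ W → len W ≡ suc ℓ) → ∃ λ x → (Σ (Walk a x) λ W → len W ≡ ℓ) × Adj G x u × u ∉ Z
    unsnoc (W , 1+ℓ≡) =
        pt W ℓ
      , (retarget (pt-0 W) refl (segment W 0 ℓ (subst (ℓ ≤_) (sym 1+ℓ≡) (n≤1+n ℓ))) , refl)
      , subst (Adj G (pt W ℓ)) (trans (cong (pt W) (sym 1+ℓ≡)) (pt-len W)) (step W ℓ (subst (ℓ <_) (sym 1+ℓ≡) ≤-refl))
      , end-avoids W

  NoOddClosedWalk : Set
  NoOddClosedWalk = ∀ {x} (W : Walk x x) → isOdd (len W) ≡ false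

  ParityWalk : Fin n → Fin n → Bool → Set
  ParityWalk a u b = Σ (Walk a u) λ W → isOdd (len W) ≡ b

  module WithoutOddClosedWalks (no-odd : NoOddClosedWalk) where

    rest-parity : {W : Walk a b} (s : Split W) → isOdd (len (Split.rest s)) ≡ isOdd (len W)
    rest-parity s = trans (cong (_xor isOdd (len (Split.rest s))) (sym (no-odd (Split.loop s)))) (Split.parity s)

    -- A repeated vertex cuts off an even closed walk, so the parity survives.
    shorten : (W : Walk a b) → Σ (Walk a b) λ W′ → len W′ ≤ n × isOdd (len W′) ≡ isOdd (len W)
    shorten W = go W (<-wellFounded (len W))
      where
      go : ∀ {a b} (W : Walk a b) → Acc _<_ (len W) → Σ (Walk a b) λ W′ → len W′ ≤ n × isOdd (len W′) ≡ isOdd (len W)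
      go W (acc shorter) with len W ≤? n
      ... | yes ℓ≤n = W , ℓ≤n , refl
      ... | no  ℓ≰n = via repeat
        where
        via : Split W → Σ (Walk _ _) λ W′ → len W′ ≤ n × isOdd (len W′) ≡ isOdd (len W)
        via s with go (Split.rest s) (shorter (Split.rest< s))
        ... | W′ , W′≤n , W′≡rest = W′ , W′≤n , trans W′≡rest (rest-parity s)
        repeat : Split W
        repeat with pigeonhole (n<1+n n) (pt W ∘ toℕ)
        ... | i , j , i<j , pᵢ≡pⱼ = defect⇒split W i<j (≤-<-trans (s≤s⁻¹ (toℕ<n j)) (≰⇒> ℓ≰n)) (inj₁ pᵢ≡pⱼ)

    parityWalk? : ∀ a u b → Dec (ParityWalk a u b)
    parityWalk? a u b = map′ found bounded
      (anyUpTo? (λ ℓ → (isOdd ℓ Bool.≟ b) ×-dec walkOfLength? a ℓ u) (suc n))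
      where
      found : (∃ λ ℓ → ℓ < suc n × isOdd ℓ ≡ b × Σ (Walk a u) λ W → len W ≡ ℓ) → ParityWalk a u b
      found (ℓ , _ , ℓ-parity , W , ℓ≡) = W , trans (cong isOdd ℓ≡) ℓ-parity
      bounded : ParityWalk a u b → ∃ λ ℓ → ℓ < suc n × isOdd ℓ ≡ b × Σ (Walk a u) λ W → len W ≡ ℓ
      bounded (W , W-parity) with shorten W
      ... | W′ , W′≤n , W′≡W = len W′ , s≤s W′≤n , trans W′≡W W-parity , W′ , refl

module ParityColouring {n} (G : Graph n) {Z : Subset n} {v : Fin n} (oct : Oct G Z)
                       (no-odd : Walks.NoOddClosedWalk G (Z - v)) where

  open Walks G (Z - v)
  open WithoutOddClosedWalks no-odd

  colour : Fin n → Bool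
  colour u with parityWalk? v u true | parityWalk? v u false
  ... | yes _ | _     = true
  ... | no  _ | yes _ = false
  ... | no  _ | no  _ = proj₁ oct u

  parity-unique : ∀ {u b} → ParityWalk v u b → ¬ ParityWalk v u (not b)
  parity-unique {b = b} (W₁ , p₁) (W₂ , p₂) = true≢false (begin
    true                               ≡⟨ cong not (xor-same b) ⟨
    not (b xor b)                      ≡⟨ not-distribʳ-xor b b ⟩
    b xor not b                        ≡⟨ cong₂ _xor_ p₁ p₂ ⟨
    isOdd (len W₁) xor isOdd (len W₂)  ≡⟨ isOdd-+ (len W₁) (len W₂) ⟨
    isOdd (len (W₁ ++ reverse W₂))     ≡⟨ no-odd (W₁ ++ reverse W₂) ⟩
    false                              ∎)
    where open ≡-Reasoning

  colour-reachable : ∀ {u b} → ParityWalk v u b → colour u ≡ b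
  colour-reachable {u} {true} w with parityWalk? v u true | parityWalk? v u false
  ... | yes _ | _ = refl
  ... | no ¬w | _ = ⊥-elim (¬w w)
  colour-reachable {u} {false} w with parityWalk? v u true | parityWalk? v u false
  ... | yes w′ | _     = ⊥-elim (parity-unique w w′)
  ... | no  _  | yes _ = refl
  ... | no  _  | no ¬w = ⊥-elim (¬w w)

  colour-unreachable : ∀ {u} → (∀ b → ¬ ParityWalk v u b) → colour u ≡ proj₁ oct u
  colour-unreachable {u} ¬w with parityWalk? v u true | parityWalk? v u false
  ... | yes w | _     = ⊥-elim (¬w true w)
  ... | no  _ | yes w = ⊥-elim (¬w false w)
  ... | no  _ | no  _ = refl

  extend : ∀ {x w b} → ParityWalk v x b → Adj G x w → w ∉ Z - v → ParityWalk v w (not b)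
  extend (W , W-parity) x~w w∉ =
    W ++ edge x~w (end-avoids W) w∉ , trans (cong isOdd (+-comm (len W) 1)) (cong not W-parity)

  v-even : ParityWalk v v false
  v-even = nil (x∉p-x Z v) , refl

  oct-minus-vertex : Oct G (Z - v)
  oct-minus-vertex = colour , proper
    where
    differ : ∀ {x w b} → ParityWalk v x b → ParityWalk v w (not b) → colour x ≢ colour w
    differ r r′ = subst₂ _≢_ (sym (colour-reachable r)) (sym (colour-reachable r′)) (not-¬ refl)
    proper : ProperColouring G (Z - v) colour
    proper x w x∉ w∉ x~w = by (parityWalk? v x true) (parityWalk? v x false)
      where
      by : Dec (ParityWalk v x true) → Dec (ParityWalk v x false) → colour x ≢ colour w
      by (yes r) _       = differ r (extend r x~w w∉)
      by (no  _) (yes r) = differ r (extend r x~w w∉)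
      by (no ¬t) (no ¬f) = subst₂ _≢_ (sym (colour-unreachable ¬x)) (sym (colour-unreachable ¬w))
                             (proj₂ oct x w (x∉p-y∧x≢y⇒x∉p x∉ x≢v) (x∉p-y∧x≢y⇒x∉p w∉ w≢v) x~w)
        where
        ¬x : ∀ b → ¬ ParityWalk v x b
        ¬x true  = ¬t
        ¬x false = ¬f
        ¬w : ∀ b → ¬ ParityWalk v w b
        ¬w b r = ¬x (not b) (extend r (Adj-sym G x~w) x∉)
        x≢v : x ≢ v
        x≢v refl = ¬f v-even
        w≢v : w ≢ v
        w≢v refl = ¬w false v-even

¬onInducedOddCycle⇒¬inMinimalOct : ∀ {n} (G : Graph n) (v : Fin n) → ¬ OnInducedOddCycle G v → ¬ InMinimalOct G v
¬onInducedOddCycle⇒¬inMinimalOct G v ¬on (Z , (oct , minimal) , v∈Z) =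
  minimal (Z - v) (x∈p⇒p-x⊂p v∈Z) (ParityColouring.oct-minus-vertex G oct no-odd)
  where
  open Walks G (Z - v)
  -- The induced odd cycle found avoids Z - v; missing v it would avoid the oct Z.
  no-odd : NoOddClosedWalk
  no-odd W with isOdd (len W) in W-parity
  ... | false = refl
  ... | true with oddClosedWalk⇒inducedOddCycle W W-parity
  ...   | C , C-avoids with any? (λ i → c C i ≟ᶠ v)
  ...     | yes on-C  = ⊥-elim (¬on (C , on-C))
  ...     | no  ¬on-C = ⊥-elim (Walks.oct⇒¬inducedOddCycle G Z oct (C , λ i →
                          x∉p-y∧x≢y⇒x∉p (C-avoids i) (λ cᵢ≡v → ¬on-C (i , cᵢ≡v))))

module CycleComplement {n} (G : Graph n) (C : InducedOddCycle G) (i₀ : Fin (suc (suc (suc (m C + m C))))) where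

  L : ℕ
  L = suc (suc (suc (m C + m C)))

  x₀ : ℕ
  x₀ = toℕ i₀

  -- Alternating colours along the path x₀+1, …, L-1, 0, …, x₀-1; the wrap-around edge (L-1, 0) is proper because L is odd.
  pathColour : ℕ → Bool
  pathColour x = does (x ≤? x₀) xor isOdd x

  pathColour-proper : ∀ {x y} → x < L → x ≢ x₀ → Consecutive L x y → pathColour x ≢ pathColour y
  pathColour-proper {x} _ x≢x₀ (inj₁ refl) = step (x ≤? x₀) (suc x ≤? x₀)
    where
    step : (d : Dec (x ≤ x₀)) (d′ : Dec (suc x ≤ x₀)) → does d xor isOdd x ≢ does d′ xor isOdd (suc x)
    step (yes _)   (yes _)    = not-¬ refl
    step (yes x≤)  (no 1+x≰) = ⊥-elim (x≢x₀ (≤-antisym x≤ (s≤s⁻¹ (≰⇒> 1+x≰))))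
    step (no  x≰)  (yes 1+x≤) = ⊥-elim (x≰ (≤-trans (n≤1+n x) 1+x≤))
    step (no  _)   (no  _)    = not-¬ refl
  pathColour-proper {x} _ x≢x₀ (inj₂ (1+x≡L , refl)) = wrap (x ≤? x₀)
    where
    x-even : isOdd x ≡ false
    x-even = trans (cong isOdd (suc-injective 1+x≡L)) (trans (not-involutive _) (isOdd-double (m C)))
    wrap : (d : Dec (x ≤ x₀)) → does d xor isOdd x ≢ true
    wrap (yes x≤) _ = x≢x₀ (≤-antisym x≤ (s≤s⁻¹ (subst (x₀ <_) (sym 1+x≡L) (toℕ<n i₀))))
    wrap (no  _) x-odd = true≢false (trans (sym x-odd) x-even)

  OnPath : Pred (Fin n) 0ℓ
  OnPath u = ∃ λ i → i ≢ i₀ × c C i ≡ u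

  onPath? : Decidable OnPath
  onPath? u = any? λ i → ¬? (i ≟ᶠ i₀) ×-dec (c C i ≟ᶠ u)

  offPath : Subset n
  offPath = ∁ (fromDec onPath?)

  c∉offPath : ∀ {i} → i ≢ i₀ → c C i ∉ offPath
  c∉offPath {i} i≢i₀ = x∈p⇒x∉∁p (∈-fromDec⁺ onPath? (i , i≢i₀ , refl))

  colour : Fin n → Bool
  colour u with any? (λ i → c C i ≟ᶠ u)
  ... | yes (i , _) = pathColour (toℕ i)
  ... | no  _       = false

  colour-c : ∀ i → colour (c C i) ≡ pathColour (toℕ i)
  colour-c i with any? (λ j → c C j ≟ᶠ c C i)
  ... | yes (j , cⱼ≡cᵢ) = cong (pathColour ∘ toℕ) (inj C cⱼ≡cᵢ)
  ... | no  ∄j          = ⊥-elim (∄j (i , refl))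

  offPath-oct : Oct G offPath
  offPath-oct = colour , proper
    where
    proper : ProperColouring G offPath colour
    proper u w u∉ w∉ u~w with ∈-fromDec⁻ onPath? (x∉∁p⇒x∈p u∉) | ∈-fromDec⁻ onPath? (x∉∁p⇒x∈p w∉)
    ... | i , i≢i₀ , refl | j , j≢i₀ , refl = subst₂ _≢_ (sym (colour-c i)) (sym (colour-c j))
      (Sum.[ pathColour-proper (toℕ<n i) (i≢i₀ ∘ toℕ-injective)
           , ≢-sym ∘ pathColour-proper (toℕ<n j) (j≢i₀ ∘ toℕ-injective) ]′
        (Equivalence.to (CycAdj⇔Consecutive i j) (Equivalence.to (induced C i j) u~w)))

onInducedOddCycle⇒inMinimalOct : ∀ {n} (G : Graph n) (v : Fin n) → OnInducedOddCycle G v → InMinimalOct G v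
onInducedOddCycle⇒inMinimalOct G v (C , i₀ , cᵢ₀≡v) with ⊂-minimal (oct? G) (CycleComplement.offPath-oct G C i₀)
... | Z , Z⊆offPath , oct , minimal with v ∈? Z
...   | yes v∈Z = Z , (oct , minimal) , v∈Z
...   | no  v∉Z = ⊥-elim (Walks.oct⇒¬inducedOddCycle G Z oct (C , C-avoids))
  where
  C-avoids : ∀ i → c C i ∉ Z
  C-avoids i with i ≟ᶠ i₀
  ... | yes refl = subst (_∉ Z) (sym cᵢ₀≡v) v∉Z
  ... | no  i≢i₀ = CycleComplement.c∉offPath G C i₀ i≢i₀ ∘ Z⊆offPath

mainTheorem7 : (n : ℕ) (G : Graph n) (v : Fin n) →
    (¬ OnInducedOddCycle G v) ⇔ (¬ InMinimalOct G v)
mainTheorem7 n G v = mk⇔ (¬onInducedOddCycle⇒¬inMinimalOct G v)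
                         (λ ¬inMinimal → ¬inMinimal ∘ onInducedOddCycle⇒inMinimalOct G v)
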